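{- Let $\vdash$ be a regular entailment relation for a commutative preordered group $G$, let $A,B$ be nonempty finite subsets of $G$ and $x\in G$. Then $A,A+x\vdash B$ iff $A\vdash B,B-x$.
   Context: A commutative preordered group is an abelian group $G$ with a preorder $\leqslant$ such that $a\leqslant b$ implies $a+c\leqslant b+c$. $A,B,A',B'$ denote nonempty finite subsets of $G$; $a$ stands for $\{a\}$, commas denote unions, $A\pm y=\{a\pm y:a\in A\}$. A regular entailment relation for $G$ is a relation $A\vdash B$ between nonempty finite subsets such that: (R1) $A\vdash B$ if $A\supseteq A'$, $B\supseteq B'$ and $A'\vdash B'$; (R2) $A\vdash B$ if $A,y\vdash B$ and $A\vdash B,y$; (R3) $a\vdash b$ if $a\leqslant b$; (R4) $A\vdash B$ if $A+y\vdash B+y$; (R5) $a+u,b+v\vdash a+b,u+v$ for all $a,b,u,v\in G$. -}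

module Defs where

open import Level using (Level; suc; _⊔_)
open import Relation.Binary.PropositionalEquality using (_≡_)
open import Relation.Binary.Structures using (IsPreorder)
open import Algebra.Structures using (IsAbelianGroup)
open import Data.List.NonEmpty as L⁺ using (List⁺; [_]; _∷_; _⁺++⁺_; _⁺∷ʳ_; toList)
open import Data.List.Membership.Propositional using (_∈_)
import Data.List as L

record CommPreorderedGroup (c ℓ : Level) : Set (suc (c ⊔ ℓ)) where
  infixl 6 _+_ _-_
  infix 4 _≤_
  field
    Carrier        : Set c
    _+_            : Carrier → Carrier → Carrier
    0#             : Carrier
    -_             : Carrier → Carrier
    isAbelianGroup : IsAbelianGroup _≡_ _+_ 0# -_
    _≤_            : Carrier → Carrier → Set ℓ
    isPreorder     : IsPreorder _≡_ _≤_
    compatible     : ∀ {a b} c → a ≤ b → a + c ≤ b + c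

  _-_ : Carrier → Carrier → Carrier
  a - b = a + (- b)

module _ {c ℓ : Level} (G : CommPreorderedGroup c ℓ) where
  open CommPreorderedGroup G

  -- Nonempty finite subsets of G are represented by nonempty lists;
  -- a set is the set of list elements.
  FinSet : Set c
  FinSet = List⁺ Carrier

  _⊇_ : FinSet → FinSet → Set c
  A ⊇ A' = ∀ {z} → z ∈ toList A' → z ∈ toList A

  _⊕_ : FinSet → Carrier → FinSet
  A ⊕ y = L⁺.map (_+ y) A

  _⊖_ : FinSet → Carrier → FinSet
  A ⊖ y = L⁺.map (_- y) A

  -- Regular entailment relation (R1)-(R5); "A , y" is A ∪ {y},
  -- "A , B" is A ∪ B.
  record IsRegularEntailment {r : Level} (_⊢_ : FinSet → FinSet → Set r)
         : Set (c ⊔ ℓ ⊔ r) where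
    field
      R1 : ∀ {A B A′ B′} → A ⊇ A′ → B ⊇ B′ → A′ ⊢ B′ → A ⊢ B
      R2 : ∀ {A B} y → (A ⁺∷ʳ y) ⊢ B → A ⊢ (B ⁺∷ʳ y) → A ⊢ B
      R3 : ∀ {a b} → a ≤ b → [ a ] ⊢ [ b ]
      R4 : ∀ {A B} y → (A ⊕ y) ⊢ (B ⊕ y) → A ⊢ B
      R5 : ∀ a b u v → ((a + u) ∷ L.[ b + v ]) ⊢ ((a + b) ∷ L.[ u + v ])

-- Both directions are two nested cuts closed by (R5).  For ⇒, cut the
-- elements a + x of A + x from the left; the premise A ⊢ B, B - x, a + x
-- is obtained by cutting the elements a′ - x of A - x, the cut formula
-- coming from the hypothesis translated by -x, and its leaves
-- a, a′ ⊢ a + x, a′ - x are instances of (R5).  For ⇐, dually, cut the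
-- elements b - x and then b′ + x from the right; the leaves are
-- b - x, b′ + x ⊢ b, b′.
module Submission where

open import Defs hiding (_⊕_; _⊖_; _⊇_)
open import Level using (Level)
open import Function.Base using (id; _∘_)
open import Function.Bundles using (_⇔_; mk⇔)
open import Algebra.Bundles using (AbelianGroup)
open import Algebra.Structures using (IsAbelianGroup)
import Algebra.Properties.AbelianGroup as AbelianGroupProperties
open import Data.Product using (_,_)
open import Data.Sum using (inj₁; inj₂)
import Data.List as L
open import Data.List using (List; []; _∷_)
open import Data.List.Properties using (++-assoc; ++-identityʳ)
open import Data.List.Membership.Propositional using (_∈_)
open import Data.List.Membership.Propositional.Properties
  using (∈-map⁺; ∈-map⁻; ∈-++⁺ˡ; ∈-++⁺ʳ; ∈-++⁻)
open import Data.List.Relation.Unary.Any using (here; there)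
import Data.List.NonEmpty as L⁺
open import Data.List.NonEmpty using (_⁺++⁺_; _⁺++_; _⁺∷ʳ_; toList)
open import Relation.Binary.PropositionalEquality
  using (_≡_; refl; sym; trans; cong; cong₂; subst; subst₂)

module RegularEntailment {c ℓ r : Level} (G : CommPreorderedGroup c ℓ)
  (_⊢_ : FinSet G → FinSet G → Set r) (regular : IsRegularEntailment G _⊢_) where

  open CommPreorderedGroup G
  open IsRegularEntailment regular

  infixl 6 _⊕_ _⊖_
  infix 4 _⊇_

  _⊕_ _⊖_ : FinSet G → Carrier → FinSet G
  _⊕_ = Defs._⊕_ G
  _⊖_ = Defs._⊖_ G

  _⊇_ : FinSet G → FinSet G → Set c
  _⊇_ = Defs._⊇_ G

  pair : Carrier → Carrier → FinSet G
  pair a b = a L⁺.∷ L.[ b ]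

  abelianGroup : AbelianGroup c c
  abelianGroup = record
    { Carrier = Carrier ; _≈_ = _≡_ ; _∙_ = _+_ ; ε = 0# ; _⁻¹ = -_
    ; isAbelianGroup = isAbelianGroup }

  open IsAbelianGroup isAbelianGroup using (comm; identityˡ; identityʳ)
  open AbelianGroupProperties abelianGroup
    using (//-rightDividesˡ; //-rightDividesʳ)

  -- List⁺ has η, so toList commutes definitionally with _⁺++⁺_, _⁺++_, _⁺∷ʳ_
  -- and L⁺.map: list membership lemmas apply directly, and e.g.
  -- A ⁺++ L.map (_+ x) (toList A) ⊇ A ⁺++⁺ A ⊕ x is proved by id.
  ⊇-reflexive : ∀ {A B : FinSet G} → toList A ≡ toList B → A ⊇ B
  ⊇-reflexive A≡B {z} = subst (z ∈_) (sym A≡B)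

  ⁺++⁺-⊇ˡ : ∀ {A B : FinSet G} → (A ⁺++⁺ B) ⊇ A
  ⁺++⁺-⊇ˡ = ∈-++⁺ˡ

  ⁺++⁺-⊇ʳ : ∀ {A B : FinSet G} → (A ⁺++⁺ B) ⊇ B
  ⁺++⁺-⊇ʳ {A} = ∈-++⁺ʳ (toList A)

  ⁺∷ʳ-⊇ : ∀ {A : FinSet G} {y} → (A ⁺∷ʳ y) ⊇ A
  ⁺∷ʳ-⊇ = ∈-++⁺ˡ

  ∈-⁺∷ʳ : ∀ (A : FinSet G) y → y ∈ toList (A ⁺∷ʳ y)
  ∈-⁺∷ʳ A y = ∈-++⁺ʳ (toList A) (here refl)

  pair-⊇ : ∀ {A : FinSet G} {a b} → a ∈ toList A → b ∈ toList A → A ⊇ pair a b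
  pair-⊇ a∈A b∈A (here refl)         = a∈A
  pair-⊇ a∈A b∈A (there (here refl)) = b∈A

  ⊕-⊖-⊇ : ∀ A y → (A ⊕ y ⊖ y) ⊇ A
  ⊕-⊖-⊇ A y {a} a∈A =
    subst (_∈ toList (A ⊕ y ⊖ y)) (//-rightDividesʳ y a) (∈-map⁺ _ (∈-map⁺ _ a∈A))

  ⁺++⁺-map-⊇ : ∀ (f g : Carrier → Carrier) → (∀ a → g (f a) ≡ a) → ∀ A →
               (A ⁺++⁺ L⁺.map g A) ⊇ L⁺.map g (A ⁺++⁺ L⁺.map f A)
  ⁺++⁺-map-⊇ f g gf A z∈ with ∈-map⁻ g z∈
  ... | w , w∈ , refl with ∈-++⁻ (toList A) w∈
  ...   | inj₁ w∈A  = ∈-++⁺ʳ (toList A) (∈-map⁺ g w∈A)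
  ...   | inj₂ w∈fA with ∈-map⁻ f w∈fA
  ...     | a , a∈A , refl = ∈-++⁺ˡ (subst (_∈ toList A) (sym (gf a)) a∈A)

  translate : ∀ {A B} y → A ⊢ B → (A ⊕ y) ⊢ (B ⊕ y)
  translate {A} {B} y A⊢B = R4 (- y) (R1 (⊕-⊖-⊇ A y) (⊕-⊖-⊇ B y) A⊢B)

  transfer : ∀ a b x → pair a b ⊢ pair (a + x) (b - x)
  transfer a b x = subst₂ _⊢_
    (cong₂ pair (identityʳ a) (trans (comm x (b - x)) (//-rightDividesˡ x b)))
    (cong (pair (a + x)) (identityˡ (b - x)))
    (R5 a x 0# (b - x))

  cutˡ : ∀ {Γ Δ} (f : Carrier → Carrier) (X : List Carrier) →
         (Γ ⁺++ L.map f X) ⊢ Δ → (∀ {x} → x ∈ X → Γ ⊢ (Δ ⁺∷ʳ f x)) → Γ ⊢ Δ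
  cutˡ {Γ} f [] ⊢Δ _ = R1 (⊇-reflexive (sym (++-identityʳ (toList Γ)))) id ⊢Δ
  cutˡ {Γ} f (x ∷ X) ⊢Δ ⊢Δ,f = R2 (f x)
    (cutˡ f X (R1 (⊇-reflexive (++-assoc (toList Γ) L.[ f x ] (L.map f X))) id ⊢Δ)
              (R1 ⁺∷ʳ-⊇ id ∘ ⊢Δ,f ∘ there))
    (⊢Δ,f (here refl))

  cutʳ : ∀ {Γ Δ} (f : Carrier → Carrier) (X : List Carrier) →
         Γ ⊢ (Δ ⁺++ L.map f X) → (∀ {x} → x ∈ X → (Γ ⁺∷ʳ f x) ⊢ Δ) → Γ ⊢ Δ
  cutʳ {Δ = Δ} f [] Γ⊢ _ = R1 id (⊇-reflexive (sym (++-identityʳ (toList Δ)))) Γ⊢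
  cutʳ {Δ = Δ} f (x ∷ X) Γ⊢ Γ,f⊢ = R2 (f x)
    (Γ,f⊢ (here refl))
    (cutʳ f X (R1 id (⊇-reflexive (++-assoc (toList Δ) L.[ f x ] (L.map f X))) Γ⊢)
              (R1 id ⁺∷ʳ-⊇ ∘ Γ,f⊢ ∘ there))

  ⊕ˡ⇒⊖ʳ : ∀ A B x → (A ⁺++⁺ A ⊕ x) ⊢ B → A ⊢ (B ⁺++⁺ B ⊖ x)
  ⊕ˡ⇒⊖ʳ A B x A,A+x⊢B =
    cutˡ (_+ x) (toList A) (R1 id ⁺++⁺-⊇ˡ A,A+x⊢B) λ a∈A →
    cutˡ (_- x) (toList A) (R1 id ⁺∷ʳ-⊇ A,A-x⊢Δ) λ a′∈A →
    R1 (pair-⊇ a∈A a′∈A) (pair-⊇ (⁺∷ʳ-⊇ (∈-⁺∷ʳ Δ _)) (∈-⁺∷ʳ _ _)) (transfer _ _ x)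
    where
    Δ = B ⁺++⁺ B ⊖ x
    A,A-x⊢Δ : (A ⁺++⁺ A ⊖ x) ⊢ Δ
    A,A-x⊢Δ = R1 (⁺++⁺-map-⊇ (_+ x) (_- x) (//-rightDividesʳ x) A) ⁺++⁺-⊇ʳ
                 (translate (- x) A,A+x⊢B)

  ⊖ʳ⇒⊕ˡ : ∀ A B x → A ⊢ (B ⁺++⁺ B ⊖ x) → (A ⁺++⁺ A ⊕ x) ⊢ B
  ⊖ʳ⇒⊕ˡ A B x A⊢B,B-x =
    cutʳ (_- x) (toList B) (R1 ⁺++⁺-⊇ˡ id A⊢B,B-x) λ b∈B →
    cutʳ (_+ x) (toList B) (R1 ⁺∷ʳ-⊇ id Γ⊢B,B+x) λ b′∈B →
    R1 (pair-⊇ (⁺∷ʳ-⊇ (∈-⁺∷ʳ Γ _)) (∈-⁺∷ʳ _ _))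
       (pair-⊇ (subst (_∈ toList B) (sym (//-rightDividesˡ x _)) b∈B)
               (subst (_∈ toList B) (sym (//-rightDividesʳ x _)) b′∈B))
       (transfer _ _ x)
    where
    Γ = A ⁺++⁺ A ⊕ x
    Γ⊢B,B+x : Γ ⊢ (B ⁺++⁺ B ⊕ x)
    Γ⊢B,B+x = R1 ⁺++⁺-⊇ʳ (⁺++⁺-map-⊇ (_- x) (_+ x) (//-rightDividesˡ x) B)
                 (translate x A⊢B,B-x)

open Defs using (_⊕_; _⊖_)

lemma1p4 : ∀ {c ℓ r : Level} (G : CommPreorderedGroup c ℓ)
             (_⊢_ : FinSet G → FinSet G → Set r) →
             IsRegularEntailment G _⊢_ →
             ∀ (A B : FinSet G) (x : CommPreorderedGroup.Carrier G) →
             ((A ⁺++⁺ _⊕_ G A x) ⊢ B) ⇔ (A ⊢ (B ⁺++⁺ _⊖_ G B x))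
lemma1p4 G _⊢_ regular A B x =
  mk⇔ (⊕ˡ⇒⊖ʳ A B x) (⊖ʳ⇒⊕ˡ A B x)
  where open RegularEntailment G _⊢_ regular
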